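{- Let $p$ be a rational prime, $x,y\in\mathbb{Z}$, and let $\mathfrak{p}_1,\mathfrak{p}_2$ be prime ideals of $\mathcal{O}_K$ lying above $p$ with $\mathfrak{p}_1,\mathfrak{p}_2\mid x+y\zeta$. Then at least one of the following holds: (1) $p\mid x$ and $p\mid y$; (2) $\mathfrak{p}_1=\mathfrak{p}_2$ and $N\mathfrak{p}_1=p$. In particular, if $p\nmid\gcd(x,y)$, then for every $m\ge 1$: $p^m\mid N(x+y\zeta)$ if and only if there exists a prime $\mathfrak{p}\mid p$ with $N\mathfrak{p}=p$ and $\mathfrak{p}^m\mid x+y\zeta$.
   Context: $K=\mathbb{Q}(\zeta)$ with $\zeta$ a primitive $8$th root of unity, $\mathcal{O}_K=\mathbb{Z}[\zeta]$; $N$ denotes the absolute norm (of elements and ideals). -}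

module Defs where

open import Data.Nat using (ℕ; zero; suc)
open import Data.Integer using (ℤ; +_; _+_; _*_; -_; _-_)
open import Data.Fin using (Fin)
open import Data.Product using (Σ; _×_; _,_)
open import Data.Sum using (_⊎_)
open import Data.Unit using (⊤)
open import Relation.Binary.PropositionalEquality using (_≡_)
open import Relation.Nullary using (¬_)

-- O_K = ℤ[ζ], ζ a primitive 8th root of unity, ζ^4 = -1.
-- An element a0 + a1 ζ + a2 ζ² + a3 ζ³ (ℤ-basis 1, ζ, ζ², ζ³).
record O : Set where
  constructor ⟨_,_,_,_⟩
  field
    a0 a1 a2 a3 : ℤ
open O public

infixl 6 _⊕_ _⊖_
infixl 7 _⊛_

_⊕_ : O → O → O
⟨ a0 , a1 , a2 , a3 ⟩ ⊕ ⟨ b0 , b1 , b2 , b3 ⟩ = ⟨ a0 + b0 , a1 + b1 , a2 + b2 , a3 + b3 ⟩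

⊝_ : O → O
⊝ ⟨ a0 , a1 , a2 , a3 ⟩ = ⟨ - a0 , - a1 , - a2 , - a3 ⟩

_⊖_ : O → O → O
a ⊖ b = a ⊕ (⊝ b)

-- multiplication modulo ζ^4 + 1
_⊛_ : O → O → O
⟨ a0 , a1 , a2 , a3 ⟩ ⊛ ⟨ b0 , b1 , b2 , b3 ⟩ =
  ⟨ a0 * b0 - a1 * b3 - a2 * b2 - a3 * b1
  , a0 * b1 + a1 * b0 - a2 * b3 - a3 * b2
  , a0 * b2 + a1 * b1 + a2 * b0 - a3 * b3
  , a0 * b3 + a1 * b2 + a2 * b1 + a3 * b0 ⟩

0O : O
0O = ⟨ + 0 , + 0 , + 0 , + 0 ⟩

1O : O
1O = ⟨ + 1 , + 0 , + 0 , + 0 ⟩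

ι : ℤ → O
ι n = ⟨ n , + 0 , + 0 , + 0 ⟩

lin : ℤ → ℤ → O
lin x y = ⟨ x , y , + 0 , + 0 ⟩

-- Absolute norm N_{K/ℚ}(α) = ∏ of the four conjugates.
-- Writing α = E + ζ·F with E = a0 + a2 i, F = a1 + a3 i (i = ζ²), the
-- relative norm to ℚ(i) is α(ζ)α(-ζ) = E² - i F² = re + im·i, and
-- N(α) = re² + im².
normO : O → ℤ
normO ⟨ a0 , a1 , a2 , a3 ⟩ = re * re + im * im
  where
  re = a0 * a0 - a2 * a2 + (+ 2) * a1 * a3
  im = (+ 2) * a0 * a2 - a1 * a1 + a3 * a3

record IsIdeal (I : O → Set) : Set where
  field
    zero∈ : I 0O
    +-closed : ∀ {a b} → I a → I b → I (a ⊕ b)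
    *-closed : ∀ r {a} → I a → I (r ⊛ a)

record IsPrimeIdeal (P : O → Set) : Set where
  field
    isIdeal : IsIdeal P
    proper : ¬ P 1O
    prime : ∀ a b → P (a ⊛ b) → P a ⊎ P b

_≐_ : (O → Set) → (O → Set) → Set
I ≐ J = ∀ a → (I a → J a) × (J a → I a)

-- "𝔭 lies above p": p ∈ 𝔭 (equivalently 𝔭 ∣ pO_K).
LiesAbove : (O → Set) → ℕ → Set
LiesAbove P p = P (ι (+ p))

-- "𝔞 ∣ α" for an ideal 𝔞 and an element α: α ∈ 𝔞 (divisibility = containment
-- in the Dedekind domain O_K).
_∣ᵢ_ : (O → Set) → O → Set
I ∣ᵢ α = I α

-- Ideal norm N𝔞 = #(O_K/𝔞): there are elements r_0..r_{n-1} forming a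
-- complete system of pairwise incongruent residues modulo 𝔞.
HasNorm : (O → Set) → ℕ → Set
HasNorm I n =
  Σ (Fin n → O) λ r →
    (∀ a → Σ (Fin n) λ i → I (a ⊖ r i)) ×
    (∀ i j → I (r i ⊖ r j) → i ≡ j)

data Mul (I J : O → Set) : O → Set where
  mzero : Mul I J 0O
  mprod : ∀ {a b} → I a → J b → Mul I J (a ⊛ b)
  madd : ∀ {a b} → Mul I J a → Mul I J b → Mul I J (a ⊕ b)

Pow : (O → Set) → ℕ → O → Set
Pow I zero = λ _ → ⊤
Pow I (suc m) = Mul I (Pow I m)

-- Reduction modulo p of the evaluation ζ ↦ t is a ring map O → 𝔽_p as soon as t is a root of
-- Φ₈ = X⁴ + 1 modulo p; its kernel 𝔭 = (p, ζ - t) is a prime of norm p.  A prime above p containing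
-- x + yζ with p ∤ y contains ζ - t for t ≡ -x/y (mod p), hence equals that 𝔭: two such primes agree
-- and have norm p, while p ∣ y forces p ∣ x.
-- For the powers, a root t of Φ₈ modulo p at which x + yζ vanishes lifts to a root T modulo p^m
-- (by inverting y modulo p^m, or by Hensel's lemma when Φ₈′(t) = 4t³ is a unit), and then
-- 𝔭^m consists exactly of the a with p^m ∣ a(T); moreover x⁴ + y⁴ = (x + yT)(…) + y⁴ Φ₈(T).
-- The root is a double one only for p = 2, where both sides fail as soon as m ≥ 2: Φ₈ has no root
-- modulo 4, and 𝔭² lies in the kernel of O → 𝔽₂[ε]/(ε²), ζ ↦ 1 + ε, which contains x + yζ only
-- when x and y are even.
module Submission where

open import Defs
open import Data.Nat using (ℕ; _≥_; _^_)
open import Data.Nat.Primality using (Prime)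
open import Data.Integer using (ℤ; +_)
open import Data.Integer.Divisibility using (_∣_)
open import Data.Integer.GCD using (gcd)
open import Data.Product using (Σ; _×_)
open import Data.Sum using (_⊎_)
open import Relation.Nullary using (¬_)

open import Level using (0ℓ)
open import Relation.Binary.PropositionalEquality
open import Algebra.Bundles using (CommutativeRing)
open import Algebra.Structures {A = O} _≡_ using (IsCommutativeRing)
open import Algebra.Definitions {A = O} _≡_
open import Algebra.Consequences.Propositional {A = O}
  using (comm∧idˡ⇒id; comm∧invˡ⇒inv; comm∧distrˡ⇒distrʳ)
open import Tactic.RingSolver.Core.AlmostCommutativeRing
  using (AlmostCommutativeRing; fromCommutativeRing)
import Tactic.RingSolver as O-Solver
open import Data.Integer using (+0; _+_; _*_; -_; _-_; ∣_∣) renaming (_⊖_ to _⊖ℕ_)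
import Data.Integer.Properties as ℤ
open import Data.Integer.DivMod using (_%ℕ_; _/ℕ_; a≡a%ℕn+[a/ℕn]*n; n%ℕd<d)
open import Data.Integer.Divisibility.Signed as Signed using (divides) renaming (_∣_ to _∣ₛ_)
open import Data.Integer.GCD using (gcd-greatest)
open import Data.Integer.Tactic.RingSolver using (solve; solve-∀)
import Data.Nat as ℕ
open import Data.Nat using (zero; suc; _<_)
import Data.Nat.Properties as ℕ
import Data.Nat.Divisibility as ℕ
open import Data.Nat.Coprimality using (Coprime; coprime-Bézout)
open import Data.Nat.GCD using (module Bézout)
open import Data.Nat.Primality using (euclidsLemma; prime⇒irreducible; prime⇒nonZero; ¬prime[0]; ¬prime[1])
open import Data.Fin using (Fin; toℕ; fromℕ<) renaming (zero to fzero; suc to fsuc)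
import Data.Fin.Properties as Fin
open import Data.Empty using (⊥-elim)
open import Data.List using (_∷_; [])
open import Data.Maybe using (Maybe; just; nothing)
open import Data.Product using (_,_; proj₁; proj₂; ∃₂) renaming (map₂ to Σ-map₂)
import Data.Product as Product
open import Data.Sum using (inj₁; inj₂)
import Data.Sum as Sum
open import Data.Unit using (tt)
open import Function using (_∘_; id)
open import Function.Bundles using (_⇔_; mk⇔; module Equivalence)
open import Relation.Nullary using (yes; no)

-- Identities in O are proved componentwise by the integer ring solver, which only sees through
-- one layer of operations applied to explicit quadruples: deeper expressions are restated
-- unfolded, or spelled out component by component.
O-ext : ∀ {a0 a1 a2 a3 b0 b1 b2 b3 : ℤ} → a0 ≡ b0 → a1 ≡ b1 → a2 ≡ b2 → a3 ≡ b3 →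
        ⟨ a0 , a1 , a2 , a3 ⟩ ≡ ⟨ b0 , b1 , b2 , b3 ⟩
O-ext refl refl refl refl = refl

⊕-assoc : Associative _⊕_
⊕-assoc ⟨ a0 , a1 , a2 , a3 ⟩ ⟨ b0 , b1 , b2 , b3 ⟩ ⟨ c0 , c1 , c2 , c3 ⟩ =
  O-ext (ℤ.+-assoc a0 b0 c0) (ℤ.+-assoc a1 b1 c1) (ℤ.+-assoc a2 b2 c2) (ℤ.+-assoc a3 b3 c3)

⊕-comm : Commutative _⊕_
⊕-comm ⟨ a0 , a1 , a2 , a3 ⟩ ⟨ b0 , b1 , b2 , b3 ⟩ =
  O-ext (ℤ.+-comm a0 b0) (ℤ.+-comm a1 b1) (ℤ.+-comm a2 b2) (ℤ.+-comm a3 b3)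

⊕-identityˡ : LeftIdentity 0O _⊕_
⊕-identityˡ ⟨ a0 , a1 , a2 , a3 ⟩ =
  O-ext (ℤ.+-identityˡ a0) (ℤ.+-identityˡ a1) (ℤ.+-identityˡ a2) (ℤ.+-identityˡ a3)

⊝-inverseˡ : LeftInverse 0O ⊝_ _⊕_
⊝-inverseˡ ⟨ a0 , a1 , a2 , a3 ⟩ =
  O-ext (ℤ.+-inverseˡ a0) (ℤ.+-inverseˡ a1) (ℤ.+-inverseˡ a2) (ℤ.+-inverseˡ a3)

⊛-comm : Commutative _⊛_
⊛-comm ⟨ a0 , a1 , a2 , a3 ⟩ ⟨ b0 , b1 , b2 , b3 ⟩ = O-ext (solve vs) (solve vs) (solve vs) (solve vs)
  where vs = a0 ∷ a1 ∷ a2 ∷ a3 ∷ b0 ∷ b1 ∷ b2 ∷ b3 ∷ []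

⊛-identityˡ : LeftIdentity 1O _⊛_
⊛-identityˡ ⟨ a0 , a1 , a2 , a3 ⟩ = O-ext (solve vs) (solve vs) (solve vs) (solve vs)
  where vs = a0 ∷ a1 ∷ a2 ∷ a3 ∷ []

⊛-assoc : Associative _⊛_
⊛-assoc ⟨ a0 , a1 , a2 , a3 ⟩ ⟨ b0 , b1 , b2 , b3 ⟩ ⟨ c0 , c1 , c2 , c3 ⟩ =
  O-ext (comp₀ a0 a1 a2 a3 b0 b1 b2 b3 c0 c1 c2 c3) (comp₁ a0 a1 a2 a3 b0 b1 b2 b3 c0 c1 c2 c3)
        (comp₂ a0 a1 a2 a3 b0 b1 b2 b3 c0 c1 c2 c3) (comp₃ a0 a1 a2 a3 b0 b1 b2 b3 c0 c1 c2 c3)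
  where
  comp₀ : ∀ a0 a1 a2 a3 b0 b1 b2 b3 c0 c1 c2 c3 →
    (a0 * b0 - a1 * b3 - a2 * b2 - a3 * b1) * c0 - (a0 * b1 + a1 * b0 - a2 * b3 - a3 * b2) * c3
      - (a0 * b2 + a1 * b1 + a2 * b0 - a3 * b3) * c2 - (a0 * b3 + a1 * b2 + a2 * b1 + a3 * b0) * c1
    ≡ a0 * (b0 * c0 - b1 * c3 - b2 * c2 - b3 * c1) - a1 * (b0 * c3 + b1 * c2 + b2 * c1 + b3 * c0)
      - a2 * (b0 * c2 + b1 * c1 + b2 * c0 - b3 * c3) - a3 * (b0 * c1 + b1 * c0 - b2 * c3 - b3 * c2)
  comp₀ = solve-∀
  comp₁ : ∀ a0 a1 a2 a3 b0 b1 b2 b3 c0 c1 c2 c3 →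
    (a0 * b0 - a1 * b3 - a2 * b2 - a3 * b1) * c1 + (a0 * b1 + a1 * b0 - a2 * b3 - a3 * b2) * c0
      - (a0 * b2 + a1 * b1 + a2 * b0 - a3 * b3) * c3 - (a0 * b3 + a1 * b2 + a2 * b1 + a3 * b0) * c2
    ≡ a0 * (b0 * c1 + b1 * c0 - b2 * c3 - b3 * c2) + a1 * (b0 * c0 - b1 * c3 - b2 * c2 - b3 * c1)
      - a2 * (b0 * c3 + b1 * c2 + b2 * c1 + b3 * c0) - a3 * (b0 * c2 + b1 * c1 + b2 * c0 - b3 * c3)
  comp₁ = solve-∀
  comp₂ : ∀ a0 a1 a2 a3 b0 b1 b2 b3 c0 c1 c2 c3 →
    (a0 * b0 - a1 * b3 - a2 * b2 - a3 * b1) * c2 + (a0 * b1 + a1 * b0 - a2 * b3 - a3 * b2) * c1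
      + (a0 * b2 + a1 * b1 + a2 * b0 - a3 * b3) * c0 - (a0 * b3 + a1 * b2 + a2 * b1 + a3 * b0) * c3
    ≡ a0 * (b0 * c2 + b1 * c1 + b2 * c0 - b3 * c3) + a1 * (b0 * c1 + b1 * c0 - b2 * c3 - b3 * c2)
      + a2 * (b0 * c0 - b1 * c3 - b2 * c2 - b3 * c1) - a3 * (b0 * c3 + b1 * c2 + b2 * c1 + b3 * c0)
  comp₂ = solve-∀
  comp₃ : ∀ a0 a1 a2 a3 b0 b1 b2 b3 c0 c1 c2 c3 →
    (a0 * b0 - a1 * b3 - a2 * b2 - a3 * b1) * c3 + (a0 * b1 + a1 * b0 - a2 * b3 - a3 * b2) * c2
      + (a0 * b2 + a1 * b1 + a2 * b0 - a3 * b3) * c1 + (a0 * b3 + a1 * b2 + a2 * b1 + a3 * b0) * c0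
    ≡ a0 * (b0 * c3 + b1 * c2 + b2 * c1 + b3 * c0) + a1 * (b0 * c2 + b1 * c1 + b2 * c0 - b3 * c3)
      + a2 * (b0 * c1 + b1 * c0 - b2 * c3 - b3 * c2) + a3 * (b0 * c0 - b1 * c3 - b2 * c2 - b3 * c1)
  comp₃ = solve-∀

⊛-distribˡ : _⊛_ DistributesOverˡ _⊕_
⊛-distribˡ ⟨ a0 , a1 , a2 , a3 ⟩ ⟨ b0 , b1 , b2 , b3 ⟩ ⟨ c0 , c1 , c2 , c3 ⟩ =
  O-ext (comp₀ a0 a1 a2 a3 b0 b1 b2 b3 c0 c1 c2 c3) (comp₁ a0 a1 a2 a3 b0 b1 b2 b3 c0 c1 c2 c3)
        (comp₂ a0 a1 a2 a3 b0 b1 b2 b3 c0 c1 c2 c3) (comp₃ a0 a1 a2 a3 b0 b1 b2 b3 c0 c1 c2 c3)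
  where
  comp₀ : ∀ a0 a1 a2 a3 b0 b1 b2 b3 c0 c1 c2 c3 →
    a0 * (b0 + c0) - a1 * (b3 + c3) - a2 * (b2 + c2) - a3 * (b1 + c1)
    ≡ a0 * b0 - a1 * b3 - a2 * b2 - a3 * b1 + (a0 * c0 - a1 * c3 - a2 * c2 - a3 * c1)
  comp₀ = solve-∀
  comp₁ : ∀ a0 a1 a2 a3 b0 b1 b2 b3 c0 c1 c2 c3 →
    a0 * (b1 + c1) + a1 * (b0 + c0) - a2 * (b3 + c3) - a3 * (b2 + c2)
    ≡ a0 * b1 + a1 * b0 - a2 * b3 - a3 * b2 + (a0 * c1 + a1 * c0 - a2 * c3 - a3 * c2)
  comp₁ = solve-∀
  comp₂ : ∀ a0 a1 a2 a3 b0 b1 b2 b3 c0 c1 c2 c3 →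
    a0 * (b2 + c2) + a1 * (b1 + c1) + a2 * (b0 + c0) - a3 * (b3 + c3)
    ≡ a0 * b2 + a1 * b1 + a2 * b0 - a3 * b3 + (a0 * c2 + a1 * c1 + a2 * c0 - a3 * c3)
  comp₂ = solve-∀
  comp₃ : ∀ a0 a1 a2 a3 b0 b1 b2 b3 c0 c1 c2 c3 →
    a0 * (b3 + c3) + a1 * (b2 + c2) + a2 * (b1 + c1) + a3 * (b0 + c0)
    ≡ a0 * b3 + a1 * b2 + a2 * b1 + a3 * b0 + (a0 * c3 + a1 * c2 + a2 * c1 + a3 * c0)
  comp₃ = solve-∀

O-isCommutativeRing : IsCommutativeRing _⊕_ _⊛_ ⊝_ 0O 1O
O-isCommutativeRing = record
  { isRing = record
    { +-isAbelianGroup = record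
      { isGroup = record
        { isMonoid = record
          { isSemigroup = record
            { isMagma = record { isEquivalence = isEquivalence ; ∙-cong = cong₂ _⊕_ }
            ; assoc   = ⊕-assoc
            }
          ; identity = comm∧idˡ⇒id ⊕-comm ⊕-identityˡ
          }
        ; inverse = comm∧invˡ⇒inv ⊕-comm ⊝-inverseˡ
        ; ⁻¹-cong = cong ⊝_
        }
      ; comm = ⊕-comm
      }
    ; *-cong     = cong₂ _⊛_
    ; *-assoc    = ⊛-assoc
    ; *-identity = comm∧idˡ⇒id ⊛-comm ⊛-identityˡ
    ; distrib    = ⊛-distribˡ , comm∧distrˡ⇒distrʳ ⊛-comm ⊛-distribˡ
    }
  ; *-comm = ⊛-comm
  }

O-commutativeRing : CommutativeRing 0ℓ 0ℓ
O-commutativeRing = record { isCommutativeRing = O-isCommutativeRing }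

open CommutativeRing O-commutativeRing using () renaming (zeroʳ to ⊛-zeroʳ; *-identityʳ to ⊛-identityʳ)

0O≟_ : (a : O) → Maybe (0O ≡ a)
0O≟ ⟨ +0 , +0 , +0 , +0 ⟩ = just refl
0O≟ _                     = nothing

O-ring : AlmostCommutativeRing 0ℓ 0ℓ
O-ring = fromCommutativeRing O-commutativeRing 0O≟_

ι-* : ∀ m n → ι (m * n) ≡ ι m ⊛ ι n
ι-* m n = unfolded
  where
  unfolded : ⟨ m * n , + 0 , + 0 , + 0 ⟩ ≡ ⟨ m , + 0 , + 0 , + 0 ⟩ ⊛ ⟨ n , + 0 , + 0 , + 0 ⟩
  unfolded = O-ext (solve vs) (solve vs) (solve vs) (solve vs) where vs = m ∷ n ∷ []

ι-*₄ : ∀ a b c d → ι (a * b * c * d) ≡ ι a ⊛ ι b ⊛ ι c ⊛ ι d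
ι-*₄ a b c d = trans (ι-* (a * b * c) d) (cong (_⊛ ι d) (trans (ι-* (a * b) c) (cong (_⊛ ι c) (ι-* a b))))

-- Evaluation at ζ ↦ t

ζ : O
ζ = ⟨ + 0 , + 1 , + 0 , + 0 ⟩

ζ-minus : ℤ → O
ζ-minus t = ⟨ - t , + 1 , + 0 , + 0 ⟩

ζ-minus≡ζ⊖ι : ∀ t → ζ-minus t ≡ ζ ⊖ ι t
ζ-minus≡ζ⊖ι t = O-ext (sym (ℤ.+-identityˡ (- t))) refl refl refl

ζ-minus-shift : ∀ T t → ζ-minus T ≡ ζ-minus t ⊖ ι (T - t)
ζ-minus-shift T t = O-ext (-T≡-t-[T-t] T t) refl refl refl
  where
  -T≡-t-[T-t] : ∀ T t → - T ≡ - t + - (T - t)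
  -T≡-t-[T-t] = solve-∀

Φ₈ Φ₈′ : ℤ → ℤ
Φ₈ t = t * t * t * t + + 1
Φ₈′ t = + 4 * t * t * t

eval : ℤ → O → ℤ
eval t ⟨ a0 , a1 , a2 , a3 ⟩ = a0 + a1 * t + a2 * (t * t) + a3 * (t * t * t)

eval-⊕ : ∀ t a b → eval t (a ⊕ b) ≡ eval t a + eval t b
eval-⊕ t ⟨ a0 , a1 , a2 , a3 ⟩ ⟨ b0 , b1 , b2 , b3 ⟩ = unfolded t a0 a1 a2 a3 b0 b1 b2 b3
  where
  unfolded : ∀ t a0 a1 a2 a3 b0 b1 b2 b3 →
    a0 + b0 + (a1 + b1) * t + (a2 + b2) * (t * t) + (a3 + b3) * (t * t * t)
    ≡ a0 + a1 * t + a2 * (t * t) + a3 * (t * t * t) + (b0 + b1 * t + b2 * (t * t) + b3 * (t * t * t))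
  unfolded = solve-∀

eval-⊝ : ∀ t a → eval t (⊝ a) ≡ - eval t a
eval-⊝ t ⟨ a0 , a1 , a2 , a3 ⟩ = unfolded t a0 a1 a2 a3
  where
  unfolded : ∀ t a0 a1 a2 a3 →
    - a0 + - a1 * t + - a2 * (t * t) + - a3 * (t * t * t) ≡ - (a0 + a1 * t + a2 * (t * t) + a3 * (t * t * t))
  unfolded = solve-∀

eval-⊖ : ∀ t a b → eval t (a ⊖ b) ≡ eval t a - eval t b
eval-⊖ t a b = trans (eval-⊕ t a (⊝ b)) (cong (λ e → eval t a + e) (eval-⊝ t b))

eval-ι : ∀ t n → eval t (ι n) ≡ n
eval-ι t n = unfolded t n
  where
  unfolded : ∀ t n → n + + 0 * t + + 0 * (t * t) + + 0 * (t * t * t) ≡ n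
  unfolded = solve-∀

eval-lin : ∀ t x y → eval t (lin x y) ≡ x + y * t
eval-lin t x y = unfolded t x y
  where
  unfolded : ∀ t x y → x + y * t + + 0 * (t * t) + + 0 * (t * t * t) ≡ x + y * t
  unfolded = solve-∀

eval-ζ-minus : ∀ t → eval t (ζ-minus t) ≡ + 0
eval-ζ-minus t = unfolded t
  where
  unfolded : ∀ t → - t + + 1 * t + + 0 * (t * t) + + 0 * (t * t * t) ≡ + 0
  unfolded = solve-∀

eval-ζ³⊛ζ-minus : ∀ t → eval t (⟨ + 0 , + 0 , + 0 , + 1 ⟩ ⊛ ζ-minus t) ≡ - Φ₈ t
eval-ζ³⊛ζ-minus t = unfolded t
  where
  unfolded : ∀ t → + 0 * - t - + 0 * + 0 - + 0 * + 0 - + 1 * + 1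
            + (+ 0 * + 1 + + 0 * - t - + 0 * + 0 - + 1 * + 0) * t
            + (+ 0 * + 0 + + 0 * + 1 + + 0 * - t - + 1 * + 0) * (t * t)
            + (+ 0 * + 0 + + 0 * + 0 + + 0 * + 1 + + 1 * - t) * (t * t * t)
          ≡ - (t * t * t * t + + 1)
  unfolded = solve-∀

-- The quotient collects the coefficients of ζ⁴, ζ⁵, ζ⁶ in the product, which wrap around as ζ⁴ = -1.
Φ₈∣eval-⊛ : ∀ t a b → Φ₈ t ∣ₛ eval t a * eval t b - eval t (a ⊛ b)
Φ₈∣eval-⊛ t ⟨ a0 , a1 , a2 , a3 ⟩ ⟨ b0 , b1 , b2 , b3 ⟩ =
  divides (a1 * b3 + a2 * b2 + a3 * b1 + (a2 * b3 + a3 * b2) * t + a3 * b3 * (t * t))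
          (unfolded t a0 a1 a2 a3 b0 b1 b2 b3)
  where
  unfolded : ∀ t a0 a1 a2 a3 b0 b1 b2 b3 →
    (a0 + a1 * t + a2 * (t * t) + a3 * (t * t * t)) * (b0 + b1 * t + b2 * (t * t) + b3 * (t * t * t))
      - (a0 * b0 - a1 * b3 - a2 * b2 - a3 * b1 + (a0 * b1 + a1 * b0 - a2 * b3 - a3 * b2) * t
         + (a0 * b2 + a1 * b1 + a2 * b0 - a3 * b3) * (t * t)
         + (a0 * b3 + a1 * b2 + a2 * b1 + a3 * b0) * (t * t * t))
    ≡ (a1 * b3 + a2 * b2 + a3 * b1 + (a2 * b3 + a3 * b2) * t + a3 * b3 * (t * t)) * (t * t * t * t + + 1)
  unfolded = solve-∀

∣eval-⊛ : ∀ {d} t a b → d ∣ₛ eval t a * eval t b → d ∣ₛ Φ₈ t → d ∣ₛ eval t (a ⊛ b)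
∣eval-⊛ {d} t a b d∣ab d∣Φ₈ =
  subst (d ∣ₛ_) (m-[m-n]≡n (eval t a * eval t b) (eval t (a ⊛ b)))
    (Signed.∣m∣n⇒∣m-n d∣ab (Signed.∣-trans d∣Φ₈ (Φ₈∣eval-⊛ t a b)))
  where
  m-[m-n]≡n : ∀ m n → m - (m - n) ≡ n
  m-[m-n]≡n = solve-∀

quotient : ℤ → O → O
quotient t ⟨ a0 , a1 , a2 , a3 ⟩ = ⟨ a1 + a2 * t + a3 * (t * t) , a2 + a3 * t , a3 , + 0 ⟩

remainder-theorem : ∀ t a → a ⊖ ι (eval t a) ≡ ζ-minus t ⊛ quotient t a
remainder-theorem t ⟨ a0 , a1 , a2 , a3 ⟩ = unfolded
  where
  unfolded : ⟨ a0 - (a0 + a1 * t + a2 * (t * t) + a3 * (t * t * t)) , a1 - + 0 , a2 - + 0 , a3 - + 0 ⟩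
             ≡ ⟨ - t , + 1 , + 0 , + 0 ⟩ ⊛ ⟨ a1 + a2 * t + a3 * (t * t) , a2 + a3 * t , a3 , + 0 ⟩
  unfolded = O-ext (solve vs) (solve vs) (solve vs) (solve vs) where vs = t ∷ a0 ∷ a1 ∷ a2 ∷ a3 ∷ []

∣-* : ∀ {d e a b} → d ∣ₛ a → e ∣ₛ b → d * e ∣ₛ a * b
∣-* {e = e} {a} d∣a e∣b = Signed.∣-trans (Signed.*-monoˡ-∣ e d∣a) (Signed.*-monoʳ-∣ a e∣b)

p^k∣p^[1+k] : ∀ p k → + (p ^ k) ∣ₛ + (p ^ suc k)
p^k∣p^[1+k] p k = Signed.∣ᵤ⇒∣ (ℕ.n∣m*n p)

p∣p^[1+k] : ∀ p k → + p ∣ₛ + (p ^ suc k)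
p∣p^[1+k] p k = Signed.∣ᵤ⇒∣ (ℕ.m∣m*n (p ^ k))

p^[1+k]≡p^k*p : ∀ p k → + (p ^ suc k) ≡ + (p ^ k) * + p
p^[1+k]≡p^k*p p k = trans (ℤ.pos-* p (p ^ k)) (ℤ.*-comm (+ p) (+ (p ^ k)))

euclid : ∀ {p m n} → Prime p → + p ∣ₛ m * n → + p ∣ₛ m ⊎ + p ∣ₛ n
euclid {p} {m} {n} p-prime p∣mn =
  Sum.map Signed.∣ᵤ⇒∣ Signed.∣ᵤ⇒∣
    (euclidsLemma ∣ m ∣ ∣ n ∣ p-prime (subst (p ℕ.∣_) (ℤ.abs-* m n) (Signed.∣⇒∣ᵤ p∣mn)))

p∤1 : ∀ {p} → Prime p → ¬ + p ∣ₛ + 1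
p∤1 p-prime p∣1 = ¬prime[1] (subst Prime (ℕ.∣1⇒≡1 (Signed.∣⇒∣ᵤ p∣1)) p-prime)

∣⁴⇒∣ : ∀ {p} x → Prime p → + p ∣ₛ x * x * x * x → + p ∣ₛ x
∣⁴⇒∣ {p} x p-prime = peel (peel (peel id))
  where
  peel : ∀ {m} → (+ p ∣ₛ m → + p ∣ₛ x) → + p ∣ₛ m * x → + p ∣ₛ x
  peel f p∣mx = Sum.[ f , id ]′ (euclid p-prime p∣mx)

p∣2⇒p≡2 : ∀ {p} → Prime p → p ℕ.∣ 2 → p ≡ 2
p∣2⇒p≡2 {0}                 p-prime _   = ⊥-elim (¬prime[0] p-prime)
p∣2⇒p≡2 {1}                 p-prime _   = ⊥-elim (¬prime[1] p-prime)
p∣2⇒p≡2 {2}                 _       _   = refl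
p∣2⇒p≡2 {suc (suc (suc _))} _       p∣2 with ℕ.∣⇒≤ p∣2
... | ℕ.s≤s (ℕ.s≤s ())

prime∤⇒coprime : ∀ {p k} → Prime p → ¬ p ℕ.∣ k → Coprime p k
prime∤⇒coprime p-prime p∤k (d∣p , d∣k) with prime⇒irreducible p-prime d∣p
... | inj₁ d≡1  = d≡1
... | inj₂ refl = ⊥-elim (p∤k d∣k)

pos-bézout : ∀ {a b c d e} → a ℕ.+ b ℕ.* c ≡ d ℕ.* e → + a + + b * + c ≡ + d * + e
pos-bézout {a} {b} {c} {d} {e} eq = begin
  + a + + b * + c     ≡⟨ cong (λ z → + a + z) (sym (ℤ.pos-* b c)) ⟩
  + a + + (b ℕ.* c)   ≡⟨ sym (ℤ.pos-+ a (b ℕ.* c)) ⟩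
  + (a ℕ.+ b ℕ.* c)   ≡⟨ cong +_ eq ⟩
  + (d ℕ.* e)         ≡⟨ ℤ.pos-* d e ⟩
  + d * + e           ∎
  where open ≡-Reasoning

inverse-mod-ℕ : ∀ {p k} → Prime p → ¬ p ℕ.∣ k → Σ ℤ λ u → + p ∣ₛ + 1 - u * + k
inverse-mod-ℕ {p} {k} p-prime p∤k with coprime-Bézout (prime∤⇒coprime p-prime p∤k)
... | Bézout.+- x y eq = - + y , divides (+ x) (begin
  + 1 - - + y * + k   ≡⟨ 1-[-y]k≡1+yk (+ y) (+ k) ⟩
  + 1 + + y * + k     ≡⟨ pos-bézout {1} {y} {k} {x} {p} eq ⟩
  + x * + p           ∎)
  where
  open ≡-Reasoning
  1-[-y]k≡1+yk : ∀ y k → + 1 - - y * k ≡ + 1 + y * k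
  1-[-y]k≡1+yk = solve-∀
... | Bézout.-+ x y eq = + y , divides (- + x) (begin
  + 1 - + y * + k         ≡⟨ cong (λ z → + 1 - z) (sym (pos-bézout {1} {x} {p} {y} {k} eq)) ⟩
  + 1 - (+ 1 + + x * + p) ≡⟨ 1-[1+xp]≡-xp (+ x) (+ p) ⟩
  - + x * + p             ∎)
  where
  open ≡-Reasoning
  1-[1+xp]≡-xp : ∀ x p → + 1 - (+ 1 + x * p) ≡ - x * p
  1-[1+xp]≡-xp = solve-∀

inverse-mod : ∀ {p n} → Prime p → ¬ + p ∣ₛ n → Σ ℤ λ u → + p ∣ₛ + 1 - u * n
inverse-mod {p} {n} p-prime p∤n with inverse-mod-ℕ p-prime (p∤n ∘ Signed.∣ᵤ⇒∣) | ℤ.+∣i∣≡i⊎+∣i∣≡-i n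
... | u , p∣ | inj₁ ∣n∣≡n  = u , subst (λ k → + p ∣ₛ + 1 - u * k) ∣n∣≡n p∣
... | u , p∣ | inj₂ ∣n∣≡-n =
  - u , subst (λ k → + p ∣ₛ + 1 - k) (u[-n]≡[-u]n u n) (subst (λ k → + p ∣ₛ + 1 - u * k) ∣n∣≡-n p∣)
  where
  u[-n]≡[-u]n : ∀ u n → u * - n ≡ - u * n
  u[-n]≡[-u]n = solve-∀

inverse-mod-pow : ∀ {p u n} → + p ∣ₛ + 1 - u * n → ∀ m → Σ ℤ λ v → + (p ^ m) ∣ₛ + 1 - v * n
inverse-mod-pow {u = u} _ zero = u , Signed.∣ᵤ⇒∣ (ℕ.1∣ _)
inverse-mod-pow {p} {u} {n} p∣ (suc m) with inverse-mod-pow {u = u} p∣ m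
... | v , pᵐ∣ =
  v + u * (+ 1 - v * n) , subst₂ _∣ₛ_ (sym (ℤ.pos-* p (p ^ m))) ([1-un][1-vn]≡1-v′n u v n) (∣-* p∣ pᵐ∣)
  where
  [1-un][1-vn]≡1-v′n : ∀ u v n → (+ 1 - u * n) * (+ 1 - v * n) ≡ + 1 - (v + u * (+ 1 - v * n)) * n
  [1-un][1-vn]≡1-v′n = solve-∀

∣∧<⇒≡0 : ∀ {p d} → p ℕ.∣ d → d < p → d ≡ 0
∣∧<⇒≡0 {d = zero}  _   _   = refl
∣∧<⇒≡0 {d = suc _} p∣d d<p = ⊥-elim (ℕ.<⇒≱ d<p (ℕ.∣⇒≤ p∣d))

residue-unique : ∀ {p i j} → i < p → j < p → + p ∣ₛ + i - + j → i ≡ j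
residue-unique {p} {i} {j} i<p j<p p∣i-j = ℤ.+-injective (ℤ.i-j≡0⇒i≡j (+ i) (+ j) (begin
  + i - + j   ≡⟨ ℤ.[+m]-[+n]≡m⊖n i j ⟩
  i ⊖ℕ j      ≡⟨ ℤ.∣i∣≡0⇒i≡0 (∣∧<⇒≡0 p∣i⊖j ∣i⊖j∣<p) ⟩
  + 0         ∎))
  where
  open ≡-Reasoning
  p∣i⊖j : p ℕ.∣ ∣ i ⊖ℕ j ∣
  p∣i⊖j = subst (λ z → p ℕ.∣ ∣ z ∣) (ℤ.[+m]-[+n]≡m⊖n i j) (Signed.∣⇒∣ᵤ p∣i-j)
  ∣i⊖j∣<p : ∣ i ⊖ℕ j ∣ < p
  ∣i⊖j∣<p = ℕ.≤-<-trans (ℤ.∣m⊝n∣≤m⊔n i j) (ℕ.⊔-lub i<p j<p)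

module IdealProperties {I : O → Set} (I-ideal : IsIdeal I) where
  open IsIdeal I-ideal public

  ⊝-closed : ∀ {a} → I a → I (⊝ a)
  ⊝-closed {a} a∈I = subst I (⊝1⊛a≡⊝a a) (*-closed (⊝ 1O) a∈I)
    where
    ⊝1⊛a≡⊝a : ∀ a → ⊝ 1O ⊛ a ≡ ⊝ a
    ⊝1⊛a≡⊝a = O-Solver.solve-∀ O-ring

  ⊖-closed : ∀ {a b} → I a → I b → I (a ⊖ b)
  ⊖-closed a∈I b∈I = +-closed a∈I (⊝-closed b∈I)

  *-closedʳ : ∀ r {a} → I a → I (a ⊛ r)
  *-closedʳ r {a} a∈I = subst I (⊛-comm r a) (*-closed r a∈I)

  ⊖-trans : ∀ {a b c} → I (a ⊖ c) → I (b ⊖ c) → I (a ⊖ b)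
  ⊖-trans {a} {b} {c} a≈c b≈c = subst I ([a-c]-[b-c]≡a-b a b c) (⊖-closed a≈c b≈c)
    where
    [a-c]-[b-c]≡a-b : ∀ a b c → (a ⊕ ⊝ c) ⊕ ⊝ (b ⊕ ⊝ c) ≡ a ⊕ ⊝ b
    [a-c]-[b-c]≡a-b = O-Solver.solve-∀ O-ring

  congruent-∈⇔ : ∀ {a b} → I (a ⊖ b) → I a ⇔ I b
  congruent-∈⇔ {a} {b} a≈b = mk⇔ (λ a∈I → subst I (a-[a-b]≡b a b) (⊖-closed a∈I a≈b))
                                  (λ b∈I → subst I (a-b+b≡a a b) (+-closed a≈b b∈I))
    where
    a-[a-b]≡b : ∀ a b → a ⊕ ⊝ (a ⊕ ⊝ b) ≡ b
    a-[a-b]≡b = O-Solver.solve-∀ O-ring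
    a-b+b≡a : ∀ a b → a ⊕ ⊝ b ⊕ b ≡ a
    a-b+b≡a = O-Solver.solve-∀ O-ring

  ι-closed : ∀ {p n} → I (ι (+ p)) → + p ∣ₛ n → I (ι n)
  ι-closed {p} p∈I (divides q refl) = subst I (sym (ι-* q (+ p))) (*-closed (ι q) p∈I)

Mul-isIdeal : ∀ {I J} → IsIdeal I → IsIdeal (Mul I J)
Mul-isIdeal {I} {J} I-ideal = record { zero∈ = mzero ; +-closed = madd ; *-closed = closed }
  where
  open IsIdeal I-ideal
  closed : ∀ r {a} → Mul I J a → Mul I J (r ⊛ a)
  closed r mzero                 = subst (Mul I J) (sym (⊛-zeroʳ r)) mzero
  closed r (mprod {a} {b} a∈ b∈) = subst (Mul I J) (⊛-assoc r a b) (mprod (*-closed r a∈) b∈)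
  closed r (madd {a} {b} x y)    = subst (Mul I J) (sym (⊛-distribˡ r a b)) (madd (closed r x) (closed r y))

Pow-isIdeal : ∀ {I} → IsIdeal I → ∀ k → IsIdeal (Pow I k)
Pow-isIdeal I-ideal zero    = record { zero∈ = tt ; +-closed = λ _ _ → tt ; *-closed = λ _ _ → tt }
Pow-isIdeal I-ideal (suc k) = Mul-isIdeal I-ideal

Mul⊆ˡ : ∀ {I J a} → IsIdeal I → Mul I J a → I a
Mul⊆ˡ I-ideal mzero         = IsIdeal.zero∈ I-ideal
Mul⊆ˡ I-ideal (mprod a∈I _) = IdealProperties.*-closedʳ I-ideal _ a∈I
Mul⊆ˡ I-ideal (madd x y)    = IsIdeal.+-closed I-ideal (Mul⊆ˡ I-ideal x) (Mul⊆ˡ I-ideal y)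

Pow-one : ∀ {I a} → I a → Pow I 1 a
Pow-one {I} {a} a∈I = subst (Pow I 1) (⊛-identityʳ a) (mprod a∈I tt)

ι[p^k]∈Pow : ∀ {I p} → I (ι (+ p)) → ∀ k → Pow I k (ι (+ (p ^ k)))
ι[p^k]∈Pow         p∈I zero    = tt
ι[p^k]∈Pow {I} {p} p∈I (suc k) =
  subst (Pow I (suc k)) (sym (trans (cong ι (ℤ.pos-* p (p ^ k))) (ι-* (+ p) (+ (p ^ k)))))
        (mprod p∈I (ι[p^k]∈Pow p∈I k))

∣⇒ι∈Pow : ∀ {I p n} → IsIdeal I → I (ι (+ p)) → ∀ k → + (p ^ k) ∣ₛ n → Pow I k (ι n)
∣⇒ι∈Pow {I} {p} I-ideal p∈I k (divides q refl) =
  subst (Pow I k) (sym (ι-* q (+ (p ^ k)))) (IsIdeal.*-closed (Pow-isIdeal I-ideal k) (ι q) (ι[p^k]∈Pow p∈I k))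

∣⊛∈Pow : ∀ {I p n b} k → IsIdeal I → I (ι (+ p)) → + p ∣ₛ n → Pow I k b → Pow I (suc k) (ι n ⊛ b)
∣⊛∈Pow {I} {p} {b = b} k I-ideal p∈I (divides w refl) b∈Iᵏ =
  subst (Pow I (suc k)) (trans (P[Wb]≡[WP]b (ι (+ p)) (ι w) b) (cong (_⊛ b) (sym (ι-* w (+ p)))))
        (mprod p∈I (IsIdeal.*-closed (Pow-isIdeal I-ideal k) (ι w) b∈Iᵏ))
  where
  P[Wb]≡[WP]b : ∀ P W b → P ⊛ (W ⊛ b) ≡ W ⊛ P ⊛ b
  P[Wb]≡[WP]b = O-Solver.solve-∀ O-ring

≐-sym : ∀ {I J} → I ≐ J → J ≐ I
≐-sym I≐J a = proj₂ (I≐J a) , proj₁ (I≐J a)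

≐-trans : ∀ {I J K} → I ≐ J → J ≐ K → I ≐ K
≐-trans I≐J J≐K a = proj₁ (J≐K a) ∘ proj₁ (I≐J a) , proj₂ (I≐J a) ∘ proj₂ (J≐K a)

HasNorm-resp-≐ : ∀ {I J n} → I ≐ J → HasNorm I n → HasNorm J n
HasNorm-resp-≐ I≐J (r , complete , distinct) =
  r , (λ a → Σ-map₂ (proj₁ (I≐J _)) (complete a)) , (λ i j → distinct i j ∘ proj₂ (I≐J _))

-- The prime 𝔭 p t = (p, ζ - t) attached to a root t of Φ₈ modulo p

𝔭 : ℕ → ℤ → O → Set
𝔭 p t a = + p ∣ₛ eval t a

𝔭-isIdeal : ∀ {p} t → + p ∣ₛ Φ₈ t → IsIdeal (𝔭 p t)
𝔭-isIdeal {p} t p∣Φ₈ = record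
  { zero∈    = divides (+ 0) refl
  ; +-closed = λ {a} {b} p∣a p∣b → subst (+ p ∣ₛ_) (sym (eval-⊕ t a b)) (Signed.∣m∣n⇒∣m+n p∣a p∣b)
  ; *-closed = λ r {a} p∣a → ∣eval-⊛ t r a (Signed.∣n⇒∣m*n (eval t r) p∣a) p∣Φ₈
  }

𝔭-isPrimeIdeal : ∀ {p} t → Prime p → + p ∣ₛ Φ₈ t → IsPrimeIdeal (𝔭 p t)
𝔭-isPrimeIdeal {p} t p-prime p∣Φ₈ = record
  { isIdeal = 𝔭-isIdeal t p∣Φ₈
  ; proper  = p∤1 p-prime
  ; prime   = λ a b p∣ab → euclid p-prime (subst (+ p ∣ₛ_) (n+[m-n]≡m (eval t a * eval t b) (eval t (a ⊛ b)))
                (Signed.∣m∣n⇒∣m+n p∣ab (Signed.∣-trans p∣Φ₈ (Φ₈∣eval-⊛ t a b))))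
  }
  where
  n+[m-n]≡m : ∀ m n → n + (m - n) ≡ m
  n+[m-n]≡m = solve-∀

𝔭-liesAbove : ∀ {p} t → LiesAbove (𝔭 p t) p
𝔭-liesAbove {p} t = subst (+ p ∣ₛ_) (sym (eval-ι t (+ p))) Signed.∣-refl

𝔭-hasNorm : ∀ {p} t → Prime p → HasNorm (𝔭 p t) p
𝔭-hasNorm {p} t p-prime = residue , complete , distinct
  where
  instance
    p≢0 : ℕ.NonZero p
    p≢0 = prime⇒nonZero p-prime
  residue : Fin p → O
  residue i = ι (+ toℕ i)
  eval-residue : ∀ i → eval t (residue i) ≡ + toℕ i
  eval-residue i = eval-ι t (+ toℕ i)
  complete : ∀ a → Σ (Fin p) λ i → 𝔭 p t (a ⊖ residue i)
  complete a = i , divides (n /ℕ p) (begin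
    eval t (a ⊖ residue i)                     ≡⟨ eval-⊖ t a (residue i) ⟩
    n - eval t (residue i)                     ≡⟨ cong (λ z → n - z) (eval-residue i) ⟩
    n - + toℕ i                                ≡⟨ cong (λ r → n - + r) (Fin.toℕ-fromℕ< _) ⟩
    n - + (n %ℕ p)                             ≡⟨ cong (_- + (n %ℕ p)) (a≡a%ℕn+[a/ℕn]*n n p) ⟩
    + (n %ℕ p) + (n /ℕ p) * + p - + (n %ℕ p)   ≡⟨ m+n-m≡n (+ (n %ℕ p)) ((n /ℕ p) * + p) ⟩
    (n /ℕ p) * + p                             ∎)
    where
    open ≡-Reasoning
    n : ℤ
    n = eval t a
    i : Fin p
    i = fromℕ< (n%ℕd<d n p)
    m+n-m≡n : ∀ m n → m + n - m ≡ n
    m+n-m≡n = solve-∀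
  distinct : ∀ i j → 𝔭 p t (residue i ⊖ residue j) → i ≡ j
  distinct i j p∣ = Fin.toℕ-injective (residue-unique (Fin.toℕ<n i) (Fin.toℕ<n j)
    (subst (+ p ∣ₛ_) (trans (eval-⊖ t (residue i) (residue j)) (cong₂ _-_ (eval-residue i) (eval-residue j))) p∣))

module ProperIdealAbove {p} (p-prime : Prime p) {I : O → Set} (I-ideal : IsIdeal I)
                        (proper : ¬ I 1O) (p∈I : I (ι (+ p))) where
  open IdealProperties I-ideal

  ι∈⇒∣ : ∀ {n} → I (ι n) → + p ∣ₛ n
  ι∈⇒∣ {n} n∈I with + p Signed.∣? n
  ... | yes p∣n = p∣n
  ... | no  p∤n = ⊥-elim (proper (subst I (cong ι (un+[1-un]≡1 u n)) 1∈I))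
    where
    u : ℤ
    u = proj₁ (inverse-mod p-prime p∤n)
    1∈I : I (ι (u * n) ⊕ ι (+ 1 - u * n))
    1∈I = +-closed (subst I (sym (ι-* u n)) (*-closed (ι u) n∈I))
                   (ι-closed p∈I (proj₂ (inverse-mod p-prime p∤n)))
    un+[1-un]≡1 : ∀ u n → u * n + (+ 1 - u * n) ≡ + 1
    un+[1-un]≡1 = solve-∀

  ≐𝔭 : ∀ {t} → I (ζ-minus t) → I ≐ 𝔭 p t
  ≐𝔭 {t} ζ-t∈I a = ι∈⇒∣ ∘ Equivalence.to a≈eval , Equivalence.from a≈eval ∘ ι-closed p∈I
    where
    a≈eval : I a ⇔ I (ι (eval t a))
    a≈eval = congruent-∈⇔ (subst I (sym (remainder-theorem t a)) (*-closedʳ (quotient t a) ζ-t∈I))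

  Φ₈-root : ∀ {t} → I (ζ-minus t) → + p ∣ₛ Φ₈ t
  Φ₈-root {t} ζ-t∈I = subst (+ p ∣ₛ_) (ℤ.neg-involutive (Φ₈ t)) (Signed.∣m⇒∣-m
    (subst (+ p ∣ₛ_) (eval-ζ³⊛ζ-minus t) (proj₁ (≐𝔭 ζ-t∈I _) (*-closed ⟨ + 0 , + 0 , + 0 , + 1 ⟩ ζ-t∈I))))

  -- Pigeonhole: two of the p + 1 elements ζ, 0, 1, …, p - 1 share a residue class, and no two integers do.
  root-from-norm : HasNorm I p → Σ ℤ λ t → I (ζ-minus t)
  root-from-norm (r , complete , _) = collision (Fin.pigeonhole (ℕ.n<1+n p) class)
    where
    class : Fin (suc p) → Fin p
    class fzero    = proj₁ (complete ζ)
    class (fsuc j) = proj₁ (complete (ι (+ toℕ j)))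
    same-class : ∀ {a b} → proj₁ (complete a) ≡ proj₁ (complete b) → I (a ⊖ b)
    same-class {a} {b} eq = ⊖-trans {a} {b} {r (proj₁ (complete a))} (proj₂ (complete a))
                                    (subst (λ k → I (b ⊖ r k)) (sym eq) (proj₂ (complete b)))
    collision : ∃₂ (λ i j → toℕ i < toℕ j × class i ≡ class j) → Σ ℤ λ t → I (ζ-minus t)
    collision (fzero  , fsuc j , _   , same) = + toℕ j , subst I (sym (ζ-minus≡ζ⊖ι _)) (same-class same)
    collision (fsuc i , fsuc j , i<j , same) =
      ⊥-elim (ℕ.<-irrefl (residue-unique (Fin.toℕ<n i) (Fin.toℕ<n j) (ι∈⇒∣ (same-class same))) (ℕ.s<s⁻¹ i<j))

lin⊖ι≡ι⊛ζ : ∀ x y → lin x y ⊖ ι x ≡ ι y ⊛ ζ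
lin⊖ι≡ι⊛ζ x y = unfolded
  where
  unfolded : ⟨ x - x , y - + 0 , + 0 - + 0 , + 0 - + 0 ⟩ ≡ ⟨ y , + 0 , + 0 , + 0 ⟩ ⊛ ⟨ + 0 , + 1 , + 0 , + 0 ⟩
  unfolded = O-ext (solve vs) (solve vs) (solve vs) (solve vs) where vs = x ∷ y ∷ []

ι⊛ζ-minus≡lin⊖ι : ∀ x y u → ι y ⊛ ζ-minus (- (u * x)) ≡ lin x y ⊖ ι (x * (+ 1 - u * y))
ι⊛ζ-minus≡lin⊖ι x y u = unfolded
  where
  unfolded : ⟨ y , + 0 , + 0 , + 0 ⟩ ⊛ ⟨ - - (u * x) , + 1 , + 0 , + 0 ⟩
             ≡ ⟨ x - x * (+ 1 - u * y) , y - + 0 , + 0 - + 0 , + 0 - + 0 ⟩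
  unfolded = O-ext (solve vs) (solve vs) (solve vs) (solve vs) where vs = x ∷ y ∷ u ∷ []

module PrimeAbove {p} (p-prime : Prime p) {P : O → Set} (P-prime : IsPrimeIdeal P) (p∈P : P (ι (+ p))) where
  open IsPrimeIdeal P-prime using (isIdeal; proper; prime)
  open IdealProperties isIdeal
  open ProperIdealAbove p-prime isIdeal proper p∈P public

  lin∈∧p∣y⇒p∣x : ∀ {x y} → P (lin x y) → + p ∣ₛ y → + p ∣ₛ x
  lin∈∧p∣y⇒p∣x {x} {y} lin∈P p∣y = ι∈⇒∣ (Equivalence.to (congruent-∈⇔ lin≈x) lin∈P)
    where
    lin≈x : P (lin x y ⊖ ι x)
    lin≈x = subst P (sym (lin⊖ι≡ι⊛ζ x y)) (*-closedʳ ζ (ι-closed p∈P p∣y))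

  -- With u y ≡ 1 (mod p) and t = - u x, y (ζ - t) ≡ x + yζ (mod p), and y ∉ P.
  lin∈⇒ζ-minus∈ : ∀ {x y u} → ¬ + p ∣ₛ y → + p ∣ₛ + 1 - u * y → P (lin x y) → P (ζ-minus (- (u * x)))
  lin∈⇒ζ-minus∈ {x} {y} {u} p∤y p∣1-uy lin∈P =
    Sum.[ ⊥-elim ∘ p∤y ∘ ι∈⇒∣ , id ]′ (prime (ι y) (ζ-minus (- (u * x))) yζ-t∈P)
    where
    yζ-t∈P : P (ι y ⊛ ζ-minus (- (u * x)))
    yζ-t∈P = subst P (sym (ι⊛ζ-minus≡lin⊖ι x y u))
               (⊖-closed {lin x y} {ι (x * (+ 1 - u * y))} lin∈P (ι-closed p∈P (Signed.∣n⇒∣m*n x p∣1-uy)))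

primes-containing-lin : ∀ {p x y P₁ P₂} → Prime p → IsPrimeIdeal P₁ → IsPrimeIdeal P₂ →
  LiesAbove P₁ p → LiesAbove P₂ p → P₁ ∣ᵢ lin x y → P₂ ∣ᵢ lin x y →
  (+ p ∣ₛ x × + p ∣ₛ y) ⊎ (P₁ ≐ P₂ × HasNorm P₁ p)
primes-containing-lin {p} {x} {y} {P₁} {P₂} p-prime P₁-prime P₂-prime p∈P₁ p∈P₂ lin∈P₁ lin∈P₂
  with + p Signed.∣? y
... | yes p∣y = inj₁ (P₁.lin∈∧p∣y⇒p∣x lin∈P₁ p∣y , p∣y)
  where module P₁ = PrimeAbove p-prime P₁-prime p∈P₁
... | no  p∤y = inj₂ (≐-trans P₁≐𝔭 (≐-sym P₂≐𝔭) , HasNorm-resp-≐ (≐-sym P₁≐𝔭) (𝔭-hasNorm _ p-prime))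
  where
  module P₁ = PrimeAbove p-prime P₁-prime p∈P₁
  module P₂ = PrimeAbove p-prime P₂-prime p∈P₂
  u : ℤ
  u = proj₁ (inverse-mod p-prime p∤y)
  p∣1-uy : + p ∣ₛ + 1 - u * y
  p∣1-uy = proj₂ (inverse-mod p-prime p∤y)
  P₁≐𝔭 : P₁ ≐ 𝔭 p (- (u * x))
  P₁≐𝔭 = P₁.≐𝔭 (P₁.lin∈⇒ζ-minus∈ {x} {y} {u} p∤y p∣1-uy lin∈P₁)
  P₂≐𝔭 : P₂ ≐ 𝔭 p (- (u * x))
  P₂≐𝔭 = P₂.≐𝔭 (P₂.lin∈⇒ζ-minus∈ {x} {y} {u} p∤y p∣1-uy lin∈P₂)

-- Roots of Φ₈ modulo prime powers

Φ₈-root⇒p∤t : ∀ {p t} → Prime p → + p ∣ₛ Φ₈ t → ¬ + p ∣ₛ t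
Φ₈-root⇒p∤t {p} {t} p-prime p∣Φ₈ p∣t = p∤1 p-prime (subst (+ p ∣ₛ_) (t⁴+1-t⁴≡1 t) (Signed.∣m∣n⇒∣m-n p∣Φ₈ p∣t⁴))
  where
  p∣t⁴ : + p ∣ₛ t * t * t * t
  p∣t⁴ = Signed.∣n⇒∣m*n (t * t * t) p∣t
  t⁴+1-t⁴≡1 : ∀ t → t * t * t * t + + 1 - t * t * t * t ≡ + 1
  t⁴+1-t⁴≡1 = solve-∀

multiple-root⇒p≡2 : ∀ {p} t → Prime p → + p ∣ₛ Φ₈ t → + p ∣ₛ Φ₈′ t → p ≡ 2
multiple-root⇒p≡2 {p} t p-prime p∣Φ₈ p∣Φ₈′ =
  p∣2⇒p≡2 p-prime (Sum.[ id , id ]′ (euclidsLemma 2 2 p-prime (Signed.∣⇒∣ᵤ p∣4)))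
  where
  cancel-t : ∀ {m} → + p ∣ₛ m * t → + p ∣ₛ m
  cancel-t p∣mt = Sum.[ id , ⊥-elim ∘ Φ₈-root⇒p∤t p-prime p∣Φ₈ ]′ (euclid p-prime p∣mt)
  p∣4 : + p ∣ₛ + 4
  p∣4 = cancel-t (cancel-t (cancel-t p∣Φ₈′))

4∤r+4k : ∀ r k → 0 < r → r < 4 → ¬ + 4 ∣ₛ + r + + 4 * k
4∤r+4k r k 0<r r<4 4∣ = ℕ.<⇒≢ 0<r (sym (∣∧<⇒≡0 (Signed.∣⇒∣ᵤ 4∣r) r<4))
  where
  4∣r : + 4 ∣ₛ + r
  4∣r = Signed.∣m+n∣n⇒∣m 4∣ (Signed.∣m⇒∣m*n k Signed.∣-refl)

-- Writing t = r + 2q, Φ₈ t ≡ 1 + r (mod 4).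
4∤Φ₈ : ∀ t → ¬ + 4 ∣ₛ Φ₈ t
4∤Φ₈ t 4∣Φ₈ with t %ℕ 2 | a≡a%ℕn+[a/ℕn]*n t 2 | n%ℕd<d t 2
... | 0 | t≡ | _ =
  4∤r+4k 1 (+ 4 * (q * q * q * q)) (ℕ.s≤s ℕ.z≤n) (ℕ.s≤s (ℕ.s≤s ℕ.z≤n))
    (subst (+ 4 ∣ₛ_) (trans (cong Φ₈ t≡) (expand q)) 4∣Φ₈)
  where
  q : ℤ
  q = t /ℕ 2
  expand : ∀ q → (+ 0 + q * + 2) * (+ 0 + q * + 2) * (+ 0 + q * + 2) * (+ 0 + q * + 2) + + 1
            ≡ + 1 + + 4 * (+ 4 * (q * q * q * q))
  expand = solve-∀
... | 1 | t≡ | _ =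
  4∤r+4k 2 (+ 2 * q + + 6 * (q * q) + + 8 * (q * q * q) + + 4 * (q * q * q * q))
    (ℕ.s≤s ℕ.z≤n) (ℕ.s≤s (ℕ.s≤s (ℕ.s≤s ℕ.z≤n))) (subst (+ 4 ∣ₛ_) (trans (cong Φ₈ t≡) (expand q)) 4∣Φ₈)
  where
  q : ℤ
  q = t /ℕ 2
  expand : ∀ q → (+ 1 + q * + 2) * (+ 1 + q * + 2) * (+ 1 + q * + 2) * (+ 1 + q * + 2) + + 1
            ≡ + 2 + + 4 * (+ 2 * q + + 6 * (q * q) + + 8 * (q * q * q) + + 4 * (q * q * q * q))
  expand = solve-∀
... | suc (suc _) | _ | ℕ.s≤s (ℕ.s≤s ())

p²∣Φ₈⇒p∤Φ₈′ : ∀ {p} t k → Prime p → + (p ^ suc (suc k)) ∣ₛ Φ₈ t → ¬ + p ∣ₛ Φ₈′ t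
p²∣Φ₈⇒p∤Φ₈′ {p} t k p-prime p²∣Φ₈ p∣Φ₈′ = 4∤Φ₈ t (Signed.∣-trans 4∣p^[2+k] p²∣Φ₈)
  where
  p≡2 : p ≡ 2
  p≡2 = multiple-root⇒p≡2 t p-prime (Signed.∣-trans (p∣p^[1+k] p (suc k)) p²∣Φ₈) p∣Φ₈′
  4∣p^[2+k] : + 4 ∣ₛ + (p ^ suc (suc k))
  4∣p^[2+k] = subst (λ q → + 4 ∣ₛ + (q ^ suc (suc k))) (sym p≡2)
                (Signed.∣ᵤ⇒∣ (ℕ.*-monoʳ-∣ 2 (ℕ.m∣m*n {2} (2 ^ k))))

newton-step : ∀ {p m T u} → + (p ^ suc m) ∣ₛ Φ₈ T → + p ∣ₛ + 1 - u * Φ₈′ T →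
              + (p ^ suc (suc m)) ∣ₛ Φ₈ (T - u * Φ₈ T)
newton-step {p} {m} {T} {u} pᵐ⁺¹∣F p∣1-uD =
  subst₂ _∣ₛ_ (sym (p^[1+k]≡p^k*p p (suc m))) (sym (trans (taylor T (u * Φ₈ T)) (rearrange (Φ₈ T) (Φ₈′ T) u _)))
    (Signed.∣m∣n⇒∣m+n (∣-* pᵐ⁺¹∣F p∣1-uD) (Signed.∣m⇒∣m*n _ (∣-* pᵐ⁺¹∣F p∣F)))
  where
  p∣F : + p ∣ₛ Φ₈ T
  p∣F = Signed.∣-trans (p∣p^[1+k] p m) pᵐ⁺¹∣F
  taylor : ∀ T h → (T - h) * (T - h) * (T - h) * (T - h) + + 1
                   ≡ T * T * T * T + + 1 - + 4 * T * T * T * h + h * h * (+ 6 * T * T - + 4 * T * h + h * h)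
  taylor = solve-∀
  rearrange : ∀ F D u R → F - D * (u * F) + u * F * (u * F) * R ≡ F * (+ 1 - u * D) + F * F * (u * u * R)
  rearrange = solve-∀

hensel : ∀ {p t} → Prime p → p ≢ 2 → + p ∣ₛ Φ₈ t → ∀ m → Σ ℤ λ T → + (p ^ suc m) ∣ₛ Φ₈ T × + p ∣ₛ T - t
hensel {p} {t} _ _ p∣Φ₈ zero =
  t , subst (_∣ₛ Φ₈ t) (cong +_ (sym (ℕ.*-identityʳ p))) p∣Φ₈ , divides (+ 0) (ℤ.+-inverseʳ t)
hensel {p} {t} p-prime p≢2 p∣Φ₈ (suc m) = T - u * Φ₈ T , newton-step {p} {m} {T} {u} pᵐ⁺¹∣Φ₈T p∣1-uD , p∣T′-t
  where
  IH : Σ ℤ λ T → + (p ^ suc m) ∣ₛ Φ₈ T × + p ∣ₛ T - t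
  IH = hensel p-prime p≢2 p∣Φ₈ m
  T : ℤ
  T = proj₁ IH
  pᵐ⁺¹∣Φ₈T : + (p ^ suc m) ∣ₛ Φ₈ T
  pᵐ⁺¹∣Φ₈T = proj₁ (proj₂ IH)
  p∣Φ₈T : + p ∣ₛ Φ₈ T
  p∣Φ₈T = Signed.∣-trans (p∣p^[1+k] p m) pᵐ⁺¹∣Φ₈T
  inverse : Σ ℤ λ u → + p ∣ₛ + 1 - u * Φ₈′ T
  inverse = inverse-mod p-prime (p≢2 ∘ multiple-root⇒p≡2 T p-prime p∣Φ₈T)
  u : ℤ
  u = proj₁ inverse
  p∣1-uD : + p ∣ₛ + 1 - u * Φ₈′ T
  p∣1-uD = proj₂ inverse
  p∣T′-t : + p ∣ₛ T - u * Φ₈ T - t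
  p∣T′-t = subst (+ p ∣ₛ_) (T-t-uF≡T-uF-t T u (Φ₈ T) t)
             (Signed.∣m∣n⇒∣m-n (proj₂ (proj₂ IH)) (Signed.∣n⇒∣m*n u p∣Φ₈T))
    where
    T-t-uF≡T-uF-t : ∀ T u F t → T - t - u * F ≡ T - u * F - t
    T-t-uF≡T-uF-t = solve-∀

-- Taylor expansion around τ, with g = ζ - τ: 0 = ζ⁴ + 1 = Φ₈(τ) + Φ₈′(τ) g + g² (6τ² + 4τ g + g²).
newton-identity : ∀ τ U A B g → g ≡ ζ ⊖ τ → A ≡ 1O ⊖ U ⊛ (ι (+ 4) ⊛ τ ⊛ τ ⊛ τ) → B ≡ U ⊛ (τ ⊛ τ ⊛ τ ⊛ τ ⊕ 1O) →
  g ≡ A ⊛ g ⊖ B ⊖ g ⊛ (g ⊛ (U ⊛ (ι (+ 6) ⊛ τ ⊛ τ ⊕ ι (+ 4) ⊛ τ ⊛ g ⊕ g ⊛ g)))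
newton-identity τ U _ _ _ refl refl refl = taylor τ U
  where
  taylor : ∀ τ U →
    ζ ⊕ ⊝ τ ≡ (1O ⊕ ⊝ (U ⊛ (ι (+ 4) ⊛ τ ⊛ τ ⊛ τ))) ⊛ (ζ ⊕ ⊝ τ) ⊕ ⊝ (U ⊛ (τ ⊛ τ ⊛ τ ⊛ τ ⊕ 1O))
              ⊕ ⊝ ((ζ ⊕ ⊝ τ) ⊛ ((ζ ⊕ ⊝ τ) ⊛ (U ⊛ (ι (+ 6) ⊛ τ ⊛ τ ⊕ ι (+ 4) ⊛ τ ⊛ (ζ ⊕ ⊝ τ)
                                                 ⊕ (ζ ⊕ ⊝ τ) ⊛ (ζ ⊕ ⊝ τ)))))
  taylor = O-Solver.solve-∀ O-ring

ζ-minus∈Pow-step : ∀ {p} T → Prime p → ∀ k → + (p ^ suc (suc k)) ∣ₛ Φ₈ T →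
                   Pow (𝔭 p T) (suc k) (ζ-minus T) → Pow (𝔭 p T) (suc (suc k)) (ζ-minus T)
ζ-minus∈Pow-step {p} T p-prime k p^[2+k]∣Φ₈ g∈𝔭ᵏ⁺¹ =
  subst (Pow (𝔭 p T) (suc (suc k))) (sym newton) (⊖-closed {A ⊛ g ⊖ B} {C} (⊖-closed {A ⊛ g} {B} A∈ B∈) C∈)
  where
  𝔭-ideal : IsIdeal (𝔭 p T)
  𝔭-ideal = 𝔭-isIdeal T (Signed.∣-trans (p∣p^[1+k] p (suc k)) p^[2+k]∣Φ₈)
  open IdealProperties (Pow-isIdeal 𝔭-ideal (suc (suc k)))
  g : O
  g = ζ-minus T
  inverse : Σ ℤ λ u → + p ∣ₛ + 1 - u * Φ₈′ T
  inverse = inverse-mod p-prime (p²∣Φ₈⇒p∤Φ₈′ T k p-prime p^[2+k]∣Φ₈)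
  u : ℤ
  u = proj₁ inverse
  s A B C : O
  s = ι (+ 6) ⊛ ι T ⊛ ι T ⊕ ι (+ 4) ⊛ ι T ⊛ g ⊕ g ⊛ g
  A = ι (+ 1 - u * Φ₈′ T)
  B = ι (u * Φ₈ T)
  C = g ⊛ (g ⊛ (ι u ⊛ s))
  newton : g ≡ A ⊛ g ⊖ B ⊖ C
  newton = newton-identity (ι T) (ι u) A B g (ζ-minus≡ζ⊖ι T)
    (cong (1O ⊖_) (trans (ι-* u (Φ₈′ T)) (cong (ι u ⊛_) (ι-*₄ (+ 4) T T T))))
    (trans (ι-* u (Φ₈ T)) (cong (λ x → ι u ⊛ (x ⊕ 1O)) (ι-*₄ T T T T)))
  A∈ : Pow (𝔭 p T) (suc (suc k)) (A ⊛ g)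
  A∈ = ∣⊛∈Pow (suc k) 𝔭-ideal (𝔭-liesAbove T) (proj₂ inverse) g∈𝔭ᵏ⁺¹
  B∈ : Pow (𝔭 p T) (suc (suc k)) B
  B∈ = ∣⇒ι∈Pow 𝔭-ideal (𝔭-liesAbove T) (suc (suc k)) (Signed.∣n⇒∣m*n u p^[2+k]∣Φ₈)
  C∈ : Pow (𝔭 p T) (suc (suc k)) C
  C∈ = mprod {a = g} (subst (+ p ∣ₛ_) (sym (eval-ζ-minus T)) (divides (+ 0) refl))
             (IdealProperties.*-closedʳ (Pow-isIdeal 𝔭-ideal (suc k)) (ι u ⊛ s) g∈𝔭ᵏ⁺¹)

ζ-minus∈Pow : ∀ {p} T → Prime p → ∀ k → + (p ^ k) ∣ₛ Φ₈ T → Pow (𝔭 p T) k (ζ-minus T)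
ζ-minus∈Pow     T _       zero          _          = tt
ζ-minus∈Pow {p} T _       (suc zero)    _          =
  Pow-one (subst (+ p ∣ₛ_) (sym (eval-ζ-minus T)) (divides (+ 0) refl))
ζ-minus∈Pow {p} T p-prime (suc (suc k)) p^[2+k]∣Φ₈ = ζ-minus∈Pow-step T p-prime k p^[2+k]∣Φ₈
  (ζ-minus∈Pow T p-prime (suc k) (Signed.∣-trans (p^k∣p^[1+k] p (suc k)) p^[2+k]∣Φ₈))

∣eval⇒∈Pow : ∀ {p} T {a} → Prime p → ∀ k → + (p ^ k) ∣ₛ Φ₈ T → + (p ^ k) ∣ₛ eval T a → Pow (𝔭 p T) k a
∣eval⇒∈Pow     T     _       zero    _     _    = tt
∣eval⇒∈Pow {p} T {a} p-prime (suc k) pᵏ∣Φ₈ pᵏ∣a =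
  Equivalence.from (congruent-∈⇔ remainder∈) (∣⇒ι∈Pow 𝔭-ideal (𝔭-liesAbove T) (suc k) pᵏ∣a)
  where
  𝔭-ideal : IsIdeal (𝔭 p T)
  𝔭-ideal = 𝔭-isIdeal T (Signed.∣-trans (p∣p^[1+k] p k) pᵏ∣Φ₈)
  open IdealProperties (Pow-isIdeal 𝔭-ideal (suc k))
  remainder∈ : Pow (𝔭 p T) (suc k) (a ⊖ ι (eval T a))
  remainder∈ = subst (Pow (𝔭 p T) (suc k)) (sym (remainder-theorem T a))
                     (*-closedʳ (quotient T a) (ζ-minus∈Pow T p-prime (suc k) pᵏ∣Φ₈))

∈Pow⇒∣eval : ∀ {p I} T → (∀ {a} → I a → + p ∣ₛ eval T a) → ∀ k → + (p ^ k) ∣ₛ Φ₈ T →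
             ∀ {a} → Pow I k a → + (p ^ k) ∣ₛ eval T a
∈Pow⇒∣eval     T I⊆𝔭 zero    _       _ = Signed.∣ᵤ⇒∣ (ℕ.1∣ _)
∈Pow⇒∣eval     T I⊆𝔭 (suc k) _       mzero = divides (+ 0) refl
∈Pow⇒∣eval {p} T I⊆𝔭 (suc k) pᵏ⁺¹∣Φ₈ (mprod {a} {b} a∈I b∈Iᵏ) =
  subst (_∣ₛ _) (sym (ℤ.pos-* p (p ^ k)))
    (∣eval-⊛ T a b (∣-* (I⊆𝔭 a∈I) (∈Pow⇒∣eval T I⊆𝔭 k (Signed.∣-trans (p^k∣p^[1+k] p k) pᵏ⁺¹∣Φ₈) b∈Iᵏ))
                   (subst (_∣ₛ Φ₈ T) (ℤ.pos-* p (p ^ k)) pᵏ⁺¹∣Φ₈))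
∈Pow⇒∣eval     T I⊆𝔭 (suc k) pᵏ⁺¹∣Φ₈ (madd {a} {b} a∈ b∈) =
  subst (_ ∣ₛ_) (sym (eval-⊕ T a b))
    (Signed.∣m∣n⇒∣m+n (∈Pow⇒∣eval T I⊆𝔭 (suc k) pᵏ⁺¹∣Φ₈ a∈) (∈Pow⇒∣eval T I⊆𝔭 (suc k) pᵏ⁺¹∣Φ₈ b∈))

-- The prime above 2

-- The kernel of O → 𝔽₂[ε]/(ε²), ζ ↦ 1 + ε; it contains the square of 𝔭 2 1.
𝔭₂² : O → Set
𝔭₂² a = + 2 ∣ₛ eval (+ 1) a × + 2 ∣ₛ a1 a + a3 a

𝔭₂²-⊛ : ∀ a b → + 2 ∣ₛ eval (+ 1) a → + 2 ∣ₛ eval (+ 1) b → 𝔭₂² (a ⊛ b)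
𝔭₂²-⊛ a@(⟨ a0 , a1 , a2 , a3 ⟩) b@(⟨ b0 , b1 , b2 , b3 ⟩) 2∣a 2∣b =
  ∣eval-⊛ (+ 1) a b (Signed.∣n⇒∣m*n (eval (+ 1) a) 2∣b) Signed.∣-refl ,
  subst (+ 2 ∣ₛ_) (sym (product-rule a0 a1 a2 a3 b0 b1 b2 b3))
    (Signed.∣m∣n⇒∣m-n (Signed.∣m∣n⇒∣m+n (Signed.∣m⇒∣m*n (b1 + b3) 2∣a) (Signed.∣n⇒∣m*n (a1 + a3) 2∣b))
                      (Signed.∣n⇒∣m*n (a2 * b3 + a3 * b2 + a1 * b1 + a1 * b3 + a3 * b1 + a3 * b3) Signed.∣-refl))
  where
  product-rule : ∀ a0 a1 a2 a3 b0 b1 b2 b3 →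
    a0 * b1 + a1 * b0 - a2 * b3 - a3 * b2 + (a0 * b3 + a1 * b2 + a2 * b1 + a3 * b0)
    ≡ (a0 + a1 * + 1 + a2 * (+ 1 * + 1) + a3 * (+ 1 * + 1 * + 1)) * (b1 + b3)
      + (a1 + a3) * (b0 + b1 * + 1 + b2 * (+ 1 * + 1) + b3 * (+ 1 * + 1 * + 1))
      - (a2 * b3 + a3 * b2 + a1 * b1 + a1 * b3 + a3 * b1 + a3 * b3) * + 2
  product-rule = solve-∀

Mul⊆𝔭₂² : ∀ {I J c} → (∀ {a} → I a → + 2 ∣ₛ eval (+ 1) a) → (∀ {b} → J b → + 2 ∣ₛ eval (+ 1) b) →
          Mul I J c → 𝔭₂² c
Mul⊆𝔭₂² I⊆ J⊆ mzero                 = divides (+ 0) refl , divides (+ 0) refl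
Mul⊆𝔭₂² I⊆ J⊆ (mprod {a} {b} a∈ b∈) = 𝔭₂²-⊛ a b (I⊆ a∈) (J⊆ b∈)
Mul⊆𝔭₂² I⊆ J⊆ (madd {a} {b} a∈ b∈) with Mul⊆𝔭₂² I⊆ J⊆ a∈ | Mul⊆𝔭₂² I⊆ J⊆ b∈
... | 2∣a , 2∣a′ | 2∣b , 2∣b′ =
  subst (+ 2 ∣ₛ_) (sym (eval-⊕ (+ 1) a b)) (Signed.∣m∣n⇒∣m+n 2∣a 2∣b) ,
  subst (+ 2 ∣ₛ_) (interchange (a1 a) (a3 a) (a1 b) (a3 b)) (Signed.∣m∣n⇒∣m+n 2∣a′ 2∣b′)
  where
  interchange : ∀ w x y z → w + x + (y + z) ≡ w + y + (x + z)
  interchange = solve-∀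

-- 2 is totally ramified: (ζ - 1)⁴ ∈ 2O.
ζ-minus-1∈ : ∀ {P} → IsPrimeIdeal P → P (ι (+ 2)) → P (ζ-minus (+ 1))
ζ-minus-1∈ {P} P-prime 2∈P = ∈-square (∈-square (subst P fourth-power 2w∈P))
  where
  open IsPrimeIdeal P-prime
  g w : O
  g = ζ-minus (+ 1)
  w = ⟨ + 0 , - + 2 , + 3 , - + 2 ⟩
  fourth-power : ι (+ 2) ⊛ w ≡ g ⊛ g ⊛ (g ⊛ g)
  fourth-power = refl
  2w∈P : P (ι (+ 2) ⊛ w)
  2w∈P = IdealProperties.*-closedʳ isIdeal w 2∈P
  ∈-square : ∀ {a} → P (a ⊛ a) → P a
  ∈-square {a} a²∈P = Sum.[ id , id ]′ (prime a a a²∈P)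

square-above-2 : ∀ {p P x y k} → p ≡ 2 → Prime p → IsPrimeIdeal P → LiesAbove P p →
                 Pow P (suc (suc k)) (lin x y) → + p ∣ₛ x × + p ∣ₛ y
square-above-2 {P = P} {x} {y} refl 2-prime P-prime 2∈P lin∈P² = 2∣x , 2∣y
  where
  open PrimeAbove 2-prime P-prime 2∈P
  P⊆𝔭 : ∀ {a} → P a → + 2 ∣ₛ eval (+ 1) a
  P⊆𝔭 {a} = proj₁ (≐𝔭 (ζ-minus-1∈ P-prime 2∈P) a)
  lin∈𝔭₂² : 𝔭₂² (lin x y)
  lin∈𝔭₂² = Mul⊆𝔭₂² P⊆𝔭 (P⊆𝔭 ∘ Mul⊆ˡ (IsPrimeIdeal.isIdeal P-prime)) lin∈P²
  2∣y : + 2 ∣ₛ y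
  2∣y = subst (+ 2 ∣ₛ_) (ℤ.+-identityʳ y) (proj₂ lin∈𝔭₂²)
  2∣x : + 2 ∣ₛ x
  2∣x = Signed.∣m+n∣n⇒∣m (subst (+ 2 ∣ₛ_) (eval-lin (+ 1) x y) (proj₁ lin∈𝔭₂²)) (Signed.∣m⇒∣m*n (+ 1) 2∣y)

N-lin : ℤ → ℤ → ℤ
N-lin x y = x * x * x * x + y * y * y * y

normO-lin : ∀ x y → normO (lin x y) ≡ N-lin x y
normO-lin x y = unfolded x y
  where
  unfolded : ∀ x y → (x * x - + 0 * + 0 + + 2 * y * + 0) * (x * x - + 0 * + 0 + + 2 * y * + 0)
              + (+ 2 * x * + 0 - y * y + + 0 * + 0) * (+ 2 * x * + 0 - y * y + + 0 * + 0)
              ≡ x * x * x * x + y * y * y * y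
  unfolded = solve-∀

coprime⇒p∤y : ∀ {p x y} → Prime p → ¬ (+ p ∣ₛ x × + p ∣ₛ y) → + p ∣ₛ N-lin x y → ¬ + p ∣ₛ y
coprime⇒p∤y {p} {x} {y} p-prime coprime p∣N p∣y =
  coprime (∣⁴⇒∣ x p-prime (Signed.∣m+n∣n⇒∣m p∣N (Signed.∣n⇒∣m*n (y * y * y) p∣y)) , p∣y)

root-from-lin : ∀ {p x y} → Prime p → ¬ + p ∣ₛ y → ∀ m → + (p ^ m) ∣ₛ N-lin x y →
                Σ ℤ λ T → + (p ^ m) ∣ₛ Φ₈ T × + (p ^ m) ∣ₛ eval T (lin x y)
root-from-lin {p} {x} {y} p-prime p∤y m pᵐ∣N = - (x * v) , pᵐ∣Φ₈ , pᵐ∣eval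
  where
  u : ℤ
  u = proj₁ (inverse-mod p-prime p∤y)
  inverse : Σ ℤ λ v → + (p ^ m) ∣ₛ + 1 - v * y
  inverse = inverse-mod-pow {p} {u} {y} (proj₂ (inverse-mod p-prime p∤y)) m
  v : ℤ
  v = proj₁ inverse
  pᵐ∣Φ₈ : + (p ^ m) ∣ₛ Φ₈ (- (x * v))
  pᵐ∣Φ₈ = subst (+ (p ^ m) ∣ₛ_) (sym (Φ₈[-xv] x y v))
            (Signed.∣m∣n⇒∣m+n (Signed.∣n⇒∣m*n (v * v * v * v) pᵐ∣N) (Signed.∣m⇒∣m*n _ (proj₂ inverse)))
    where
    Φ₈[-xv] : ∀ x y v → - (x * v) * - (x * v) * - (x * v) * - (x * v) + + 1
                  ≡ v * v * v * v * (x * x * x * x + y * y * y * y)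
                    + (+ 1 - v * y) * ((+ 1 + v * y) * (+ 1 + v * y * (v * y)))
    Φ₈[-xv] = solve-∀
  pᵐ∣eval : + (p ^ m) ∣ₛ eval (- (x * v)) (lin x y)
  pᵐ∣eval = subst (+ (p ^ m) ∣ₛ_) (sym (trans (eval-lin (- (x * v)) x y) (x+y[-xv]≡x[1-vy] x y v)))
              (Signed.∣n⇒∣m*n x (proj₂ inverse))
    where
    x+y[-xv]≡x[1-vy] : ∀ x y v → x + y * - (x * v) ≡ x * (+ 1 - v * y)
    x+y[-xv]≡x[1-vy] = solve-∀

pᵐ∣N⇒lin∈Pᵐ : ∀ {p x y} → Prime p → ¬ (+ p ∣ₛ x × + p ∣ₛ y) → ∀ m → m ≥ 1 → + (p ^ m) ∣ₛ N-lin x y →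
  Σ (O → Set) λ P → IsPrimeIdeal P × LiesAbove P p × HasNorm P p × Pow P m ∣ᵢ lin x y
pᵐ∣N⇒lin∈Pᵐ {p} {x} {y} p-prime coprime (suc m) _ pᵐ∣N =
  𝔭 p T , 𝔭-isPrimeIdeal T p-prime (Signed.∣-trans (p∣p^[1+k] p m) pᵐ∣Φ₈) , 𝔭-liesAbove T ,
  𝔭-hasNorm T p-prime , ∣eval⇒∈Pow T p-prime (suc m) pᵐ∣Φ₈ pᵐ∣eval
  where
  root : Σ ℤ λ T → + (p ^ suc m) ∣ₛ Φ₈ T × + (p ^ suc m) ∣ₛ eval T (lin x y)
  root = root-from-lin {p} {x} {y} p-prime
           (coprime⇒p∤y p-prime coprime (Signed.∣-trans (p∣p^[1+k] p m) pᵐ∣N)) (suc m) pᵐ∣N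
  T : ℤ
  T = proj₁ root
  pᵐ∣Φ₈ : + (p ^ suc m) ∣ₛ Φ₈ T
  pᵐ∣Φ₈ = proj₁ (proj₂ root)
  pᵐ∣eval : + (p ^ suc m) ∣ₛ eval T (lin x y)
  pᵐ∣eval = proj₂ (proj₂ root)

lifted-root : ∀ {p x y P t} → Prime p → ¬ (+ p ∣ₛ x × + p ∣ₛ y) → IsPrimeIdeal P → LiesAbove P p →
              P (ζ-minus t) → ∀ m → m ≥ 1 → Pow P m (lin x y) → Σ ℤ λ T → + (p ^ m) ∣ₛ Φ₈ T × P (ζ-minus T)
lifted-root {p} {t = t} p-prime _ P-prime p∈P ζ-t∈P (suc zero) _ _ =
  t , subst (_∣ₛ Φ₈ t) (cong +_ (sym (ℕ.*-identityʳ p))) (Φ₈-root ζ-t∈P) , ζ-t∈P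
  where open PrimeAbove p-prime P-prime p∈P
lifted-root {p} {P = P} {t} p-prime coprime P-prime p∈P ζ-t∈P (suc (suc k)) _ lin∈P² with p ℕ.≟ 2
... | yes p≡2 = ⊥-elim (coprime (square-above-2 {k = k} p≡2 p-prime P-prime p∈P lin∈P²))
... | no  p≢2 = T , proj₁ (proj₂ lifted) ,
  subst P (sym (ζ-minus-shift T t)) (⊖-closed ζ-t∈P (ι-closed p∈P (proj₂ (proj₂ lifted))))
  where
  open PrimeAbove p-prime P-prime p∈P
  open IdealProperties (IsPrimeIdeal.isIdeal P-prime)
  lifted : Σ ℤ λ T → + (p ^ suc (suc k)) ∣ₛ Φ₈ T × + p ∣ₛ T - t
  lifted = hensel p-prime p≢2 (Φ₈-root ζ-t∈P) (suc k)
  T : ℤ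
  T = proj₁ lifted

lin∈Pᵐ⇒pᵐ∣N : ∀ {p x y P} → Prime p → ¬ (+ p ∣ₛ x × + p ∣ₛ y) → ∀ m → m ≥ 1 →
  IsPrimeIdeal P → LiesAbove P p → HasNorm P p → Pow P m ∣ᵢ lin x y → + (p ^ m) ∣ₛ N-lin x y
lin∈Pᵐ⇒pᵐ∣N {p} {x} {y} {P} p-prime coprime m m≥1 P-prime p∈P norm lin∈Pᵐ =
  subst (+ (p ^ m) ∣ₛ_) (sym (factorisation x y T))
    (Signed.∣m∣n⇒∣m+n (Signed.∣m⇒∣m*n _ pᵐ∣x+yT) (Signed.∣n⇒∣m*n (y * y * y * y) (proj₁ (proj₂ lifted))))
  where
  open PrimeAbove p-prime P-prime p∈P
  lifted : Σ ℤ λ T → + (p ^ m) ∣ₛ Φ₈ T × P (ζ-minus T)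
  lifted = lifted-root p-prime coprime P-prime p∈P (proj₂ (root-from-norm norm)) m m≥1 lin∈Pᵐ
  T : ℤ
  T = proj₁ lifted
  pᵐ∣x+yT : + (p ^ m) ∣ₛ x + y * T
  pᵐ∣x+yT = subst (+ (p ^ m) ∣ₛ_) (eval-lin T x y)
              (∈Pow⇒∣eval T (λ {a} → proj₁ (≐𝔭 (proj₂ (proj₂ lifted)) a)) m (proj₁ (proj₂ lifted)) lin∈Pᵐ)
  factorisation : ∀ x y T → x * x * x * x + y * y * y * y
                ≡ (x + y * T) * (x * x * x - x * x * (y * T) + x * (y * T) * (y * T) - y * T * (y * T) * (y * T))
                  + y * y * y * y * (T * T * T * T + + 1)
  factorisation = solve-∀

lemma3p2 : (p : ℕ) → Prime p → (x y : ℤ) →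
    ((P₁ P₂ : O → Set) → IsPrimeIdeal P₁ → IsPrimeIdeal P₂ →
      LiesAbove P₁ p → LiesAbove P₂ p →
      P₁ ∣ᵢ lin x y → P₂ ∣ᵢ lin x y →
      ((+ p ∣ x) × (+ p ∣ y)) ⊎ ((P₁ ≐ P₂) × HasNorm P₁ p))
    ×
    (¬ (+ p ∣ gcd x y) → (m : ℕ) → m ≥ 1 →
      ((+ (p ^ m) ∣ normO (lin x y)) →
        Σ (O → Set) λ P → IsPrimeIdeal P × LiesAbove P p × HasNorm P p × Pow P m ∣ᵢ lin x y)
      ×
      (Σ (O → Set) (λ P → IsPrimeIdeal P × LiesAbove P p × HasNorm P p × Pow P m ∣ᵢ lin x y) →
        + (p ^ m) ∣ normO (lin x y)))
lemma3p2 p p-prime x y =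
  (λ P₁ P₂ P₁-prime P₂-prime p∈P₁ p∈P₂ lin∈P₁ lin∈P₂ →
     Sum.map₁ (Product.map Signed.∣⇒∣ᵤ Signed.∣⇒∣ᵤ)
       (primes-containing-lin p-prime P₁-prime P₂-prime p∈P₁ p∈P₂ lin∈P₁ lin∈P₂)) ,
  λ p∤gcd m m≥1 →
    (λ pᵐ∣N → pᵐ∣N⇒lin∈Pᵐ p-prime (coprime p∤gcd) m m≥1
                (subst (+ (p ^ m) ∣ₛ_) (normO-lin x y) (Signed.∣ᵤ⇒∣ pᵐ∣N))) ,
    (λ (P , P-prime , p∈P , norm , lin∈Pᵐ) →
       Signed.∣⇒∣ᵤ (subst (+ (p ^ m) ∣ₛ_) (sym (normO-lin x y))
         (lin∈Pᵐ⇒pᵐ∣N p-prime (coprime p∤gcd) m m≥1 P-prime p∈P norm lin∈Pᵐ)))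
  where
  coprime : ¬ (+ p ∣ gcd x y) → ¬ (+ p ∣ₛ x × + p ∣ₛ y)
  coprime p∤gcd (p∣x , p∣y) = p∤gcd (gcd-greatest {x} {y} {+ p} (Signed.∣⇒∣ᵤ p∣x) (Signed.∣⇒∣ᵤ p∣y))
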